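{- Let $F=(W,R,R_D)$ be a finite rooted Kripke frame validating $\mathbf{DT_1CK}$, and let $w',w''\in W$ be $R_D$-reflexive. Then there is a path $\alpha=w_0w_1\dots w_n$ in $(W,R)$ with $w_0=w'$, $w_n=w''$, which is global (i.e. $\bigcup_{i=0}^n\overline{R}(w_i)=W$), and in which every $R_D$-irreflexive point occurs only once.
   Context: Formulas are built with $\bot,\to,\Box,[\neq]$; $\Diamond A:=\neg\Box\neg A$, $\langle\neq\rangle A:=\neg[\neq]\neg A$, $\overline{\Box}A:=\Box A\wedge A$. $\mathbf{DT_1CK}$ is the least normal bimodal logic containing $\Box p\to\Box\Box p$, $p\wedge[\neq]p\to[\neq][\neq]p$, $\langle\neq\rangle[\neq]p\to p$, $[\neq]p\to\Box p$, $[\neq]p\to[\neq]\Box p$, $\Diamond\top$, $\Box(\overline{\Box}p\vee\overline{\Box}\neg p)\to(\Box p\vee\Box\neg p)$ and $\big([\neq](\overline{\Box}p\vee\overline{\Box}\neg p)\wedge(\overline{\Box}p\vee\overline{\Box}\neg p)\big)\to\big(([\neq]p\wedge p)\vee([\neq]\neg p\wedge\neg p)\big)$. A Kripke frame interprets $\Box$ by $R$ and $[\neq]$ by $R_D$; it is rooted if $W=R^*(x)$ for some $x$, $R^*$ the reflexive transitive closure of $R\cup R_D$. A path in $(W,R)$ is a sequence $w_0\dots w_n$ with $w_{i}\,R^{\pm}\,w_{i+1}$ for all $i<n$, where $R^\pm=R\cup R^{ -1}\cup\{(w,w):w\in W\}$; $\overline{R}$ is the reflexive closure of $R$. -}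

module Defs where

open import Data.Nat using (ℕ; zero; suc)
open import Data.Fin using (Fin; zero; suc; fromℕ; inject₁)
open import Data.Bool using (Bool; true; false; _∧_; _∨_; not)
open import Data.Product using (Σ; ∃; _×_; _,_)
open import Data.Sum using (_⊎_)
open import Relation.Binary.PropositionalEquality using (_≡_)
open import Relation.Binary.Construct.Closure.ReflexiveTransitive using (Star)

infixr 5 _⇒_
data Fm : Set where
  var  : ℕ → Fm
  ⊥'   : Fm
  _⇒_  : Fm → Fm → Fm
  □    : Fm → Fm
  [≠]  : Fm → Fm

¬' : Fm → Fm
¬' A = A ⇒ ⊥'

⊤' : Fm
⊤' = ¬' ⊥'

_∨'_ : Fm → Fm → Fm
A ∨' B = ¬' A ⇒ B

_∧'_ : Fm → Fm → Fm
A ∧' B = ¬' (A ⇒ ¬' B)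

◇ : Fm → Fm
◇ A = ¬' (□ (¬' A))

⟨≠⟩ : Fm → Fm
⟨≠⟩ A = ¬' ([≠] (¬' A))

□̄ : Fm → Fm
□̄ A = □ A ∧' A

-- Hilbert system: classical propositional axioms (complete for ⊥,→),
-- K for both modalities, the extra axioms as schemas (= closure under
-- uniform substitution), modus ponens and necessitation for both boxes.

data DT1CK : Fm → Set where
  ax-K    : ∀ A B → DT1CK (A ⇒ B ⇒ A)
  ax-S    : ∀ A B C → DT1CK ((A ⇒ B ⇒ C) ⇒ (A ⇒ B) ⇒ A ⇒ C)
  ax-DN   : ∀ A → DT1CK (¬' (¬' A) ⇒ A)
  ax-K□   : ∀ A B → DT1CK (□ (A ⇒ B) ⇒ □ A ⇒ □ B)
  ax-K≠   : ∀ A B → DT1CK ([≠] (A ⇒ B) ⇒ [≠] A ⇒ [≠] B)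
  ax-4    : ∀ A → DT1CK (□ A ⇒ □ (□ A))
  ax-wD   : ∀ A → DT1CK ((A ∧' [≠] A) ⇒ [≠] ([≠] A))
  ax-B≠   : ∀ A → DT1CK (⟨≠⟩ ([≠] A) ⇒ A)
  ax-incl : ∀ A → DT1CK ([≠] A ⇒ □ A)
  ax-mix  : ∀ A → DT1CK ([≠] A ⇒ [≠] (□ A))
  ax-ser  : DT1CK (◇ ⊤')
  ax-c□   : ∀ A → DT1CK (□ (□̄ A ∨' □̄ (¬' A)) ⇒ (□ A ∨' □ (¬' A)))
  ax-c≠   : ∀ A → DT1CK (([≠] (□̄ A ∨' □̄ (¬' A)) ∧' (□̄ A ∨' □̄ (¬' A)))
                          ⇒ (([≠] A ∧' A) ∨' ([≠] (¬' A) ∧' ¬' A)))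
  mp      : ∀ {A B} → DT1CK (A ⇒ B) → DT1CK A → DT1CK B
  nec□    : ∀ {A} → DT1CK A → DT1CK (□ A)
  nec≠    : ∀ {A} → DT1CK A → DT1CK ([≠] A)

record Frame : Set where
  field
    size : ℕ
    R    : Fin size → Fin size → Bool
    RD   : Fin size → Fin size → Bool
open Frame public

W : Frame → Set
W F = Fin (size F)

allFin : ∀ {n} → (Fin n → Bool) → Bool
allFin {zero}  f = true
allFin {suc n} f = f zero ∧ allFin (λ i → f (suc i))

_⇒ᵇ_ : Bool → Bool → Bool
a ⇒ᵇ b = not a ∨ b

Valuation : Frame → Set
Valuation F = ℕ → W F → Bool

eval : (F : Frame) → Valuation F → W F → Fm → Bool
eval F V w (var p) = V p w
eval F V w ⊥'      = false
eval F V w (A ⇒ B) = eval F V w A ⇒ᵇ eval F V w B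
eval F V w (□ A)   = allFin (λ v → R F w v ⇒ᵇ eval F V v A)
eval F V w ([≠] A) = allFin (λ v → RD F w v ⇒ᵇ eval F V v A)

ValidIn : Frame → Fm → Set
ValidIn F A = ∀ (V : Valuation F) (w : W F) → eval F V w A ≡ true

ValidatesDT1CK : Frame → Set
ValidatesDT1CK F = ∀ A → DT1CK A → ValidIn F A

R∪RD : (F : Frame) → W F → W F → Set
R∪RD F x y = (R F x y ≡ true) ⊎ (RD F x y ≡ true)

Rooted : Frame → Set
Rooted F = ∃ λ (x : W F) → ∀ (y : W F) → Star (R∪RD F) x y

R± : (F : Frame) → W F → W F → Set
R± F x y = (R F x y ≡ true) ⊎ (R F y x ≡ true) ⊎ (x ≡ y)

IsPath : (F : Frame) (k : ℕ) → (Fin (suc k) → W F) → Set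
IsPath F k α = ∀ (i : Fin k) → R± F (α (inject₁ i)) (α (suc i))

IsGlobal : (F : Frame) (k : ℕ) → (Fin (suc k) → W F) → Set
IsGlobal F k α = ∀ (v : W F) → ∃ λ (i : Fin (suc k)) → (α i ≡ v) ⊎ (R F (α i) v ≡ true)

IrreflOnce : (F : Frame) (k : ℕ) → (Fin (suc k) → W F) → Set
IrreflOnce F k α = ∀ (i j : Fin (suc k)) → RD F (α i) (α i) ≡ false → α i ≡ α j → i ≡ j

-- The axioms of DT1CK force R ⊆ R_D, symmetry and weak transitivity of R_D, R_D ; R ⊆ R_D and
-- seriality of R. In a rooted frame R_D then relates any two distinct points, so an R_D-irreflexive
-- point has no R-predecessor and every R-successor is R_D-reflexive.
-- Any two R_D-reflexive points a, b are joined by R^±-steps between R_D-reflexive points: let T be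
-- the component of a and evaluate p at each point by T at the point itself, or at an R-successor if the
-- point is irreflexive. The axiom □(□̄p ∨ □̄¬p) → □p ∨ □¬p makes this valuation satisfy □̄p ∨ □̄¬p
-- everywhere, and the [≠]-axiom then forces p to be constant on R_D(a) ∪ {a}, so T contains b.
-- The path visits all points in turn, always passing through R_D-reflexive points; an irreflexive
-- point v, having no R-predecessor, must lie on a global path itself; it is visited by the detour
-- z v z for an R-successor z of v. Hence every irreflexive point occurs exactly once.

module Submission where

open import Defs
open import Data.Bool using (Bool; true; false; _∨_)
open import Data.Bool.Properties using (∨-zeroʳ) renaming (_≟_ to _≟ᵇ_)
open import Data.Empty using (⊥-elim)
open import Data.Fin using (Fin; zero; suc; fromℕ; _≟_)
open import Data.Fin.Properties using (any?)
open import Data.Fin.Subset using (Subset; _∈_; _∉_; _∪_; ⁅_⁆; _⊃_)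
open import Data.Fin.Subset.Properties using (x∈⁅x⁆; x∈⁅y⁆⇒x≡y; p⊆p∪q; x∈p∪q⁺; x∈p∪q⁻; _∈?_)
open import Data.Fin.Subset.Induction using (⊃-wellFounded)
open import Data.List using (List; []; _∷_; _++_; [_]; length; lookup; filter)
import Data.List as List
open import Data.List.Properties using (filter-++; filter-accept; filter-reject; filter-none; ++-identityʳ)
open import Data.List.Membership.Propositional using () renaming (_∈_ to _∈ˡ_)
open import Data.List.Membership.Propositional.Properties using (∈-++⁺ˡ; ∈-++⁺ʳ; ∈-++⁻; ∈-filter⁺; ∈-lookup; ∈-allFin)
open import Data.List.Relation.Unary.All using (All; []; _∷_)
import Data.List.Relation.Unary.All as All
open import Data.List.Relation.Unary.AllPairs using (_∷_)
open import Data.List.Relation.Unary.Any using (here; there; index)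
open import Data.List.Relation.Unary.Any.Properties using (lookup-index)
open import Data.List.Relation.Unary.Unique.Propositional using (Unique)
import Data.List.Relation.Unary.Unique.Propositional.Properties as Unique
open import Data.Nat using (ℕ; zero; suc)
open import Data.Product using (∃; _×_; _,_; proj₁; proj₂; map₂)
open import Data.Sum using (_⊎_; inj₁; inj₂; swap)
import Data.Sum as Sum
open import Function using (_∘_; id; mk⇔)
open import Induction.WellFounded using (Acc; acc)
open import Level using (0ℓ)
open import Relation.Binary using (Rel; Decidable)
open import Relation.Binary.Construct.Closure.ReflexiveTransitive using (Star; ε; _◅_; _◅◅_)
open import Relation.Binary.PropositionalEquality hiding ([_])
open import Relation.Nullary using (Dec; does; yes; no; ¬_; ¬?; _×-dec_; _⊎-dec_)
open import Relation.Nullary.Decidable using (dec-true; dec-false; decidable-stable; does-⇔)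
open import Relation.Unary using (Pred) renaming (Decidable to Decidable₁)

allFin≡true⁺ : ∀ {n} {f : Fin n → Bool} → (∀ i → f i ≡ true) → allFin f ≡ true
allFin≡true⁺ {zero}  h = refl
allFin≡true⁺ {suc n} h rewrite h zero = allFin≡true⁺ (λ i → h (suc i))

allFin≡true⁻ : ∀ {n} {f : Fin n → Bool} → allFin f ≡ true → ∀ i → f i ≡ true
allFin≡true⁻ {suc n} {f} h i with f zero in eq
allFin≡true⁻ {suc n} {f} h zero    | true = eq
allFin≡true⁻ {suc n} {f} h (suc i) | true = allFin≡true⁻ h i

allFin≡false⁺ : ∀ {n} {f : Fin n → Bool} i → f i ≡ false → allFin f ≡ false
allFin≡false⁺ zero    h rewrite h = refl
allFin≡false⁺ {f = f} (suc i) h with f zero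
... | true  = allFin≡false⁺ i h
... | false = refl

allFin≡false⁻ : ∀ {n} {f : Fin n → Bool} → allFin f ≡ false → ∃ λ i → f i ≡ false
allFin≡false⁻ {suc n} {f} h with f zero in eq
... | false = zero , eq
... | true  with i , fi ← allFin≡false⁻ h = suc i , fi

⇒ᵇ-intro : ∀ {a b} → (a ≡ true → b ≡ true) → (a ⇒ᵇ b) ≡ true
⇒ᵇ-intro {false} h = refl
⇒ᵇ-intro {true}  h = h refl

⇒ᵇ-elim : ∀ {a b} → (a ⇒ᵇ b) ≡ true → a ≡ true → b ≡ true
⇒ᵇ-elim h refl = h

⇒ᵇ≡false⁻ : ∀ {a b} → (a ⇒ᵇ b) ≡ false → a ≡ true × b ≡ false
⇒ᵇ≡false⁻ {true} h = refl , h

⇒ᵇ≡false⁺ : ∀ {a b} → a ≡ true → b ≡ false → (a ⇒ᵇ b) ≡ false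
⇒ᵇ≡false⁺ refl refl = refl

module Semantics (F : Frame) (V : Valuation F) where

  -- A record rather than a synonym for eval ≡ true, so that the formula is inferable.
  infix 4 _⊩_
  record _⊩_ (w : W F) (A : Fm) : Set where
    constructor holds
    field truth : eval F V w A ≡ true
  open _⊩_ public

  private
    variable
      w v : W F
      A B : Fm

  valid⇒⊩ : ValidatesDT1CK F → DT1CK A → w ⊩ A
  valid⇒⊩ valid d = holds (valid _ d V _)

  ⊩⇒⁻ : w ⊩ A ⇒ B → w ⊩ A → w ⊩ B
  ⊩⇒⁻ (holds i) (holds a) = holds (⇒ᵇ-elim i a)

  ⊩¬⁺ : eval F V w A ≡ false → w ⊩ ¬' A
  ⊩¬⁺ h = holds (⇒ᵇ-intro (λ a → trans (sym h) a))

  ⊩¬⁻ : w ⊩ ¬' A → eval F V w A ≡ false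
  ⊩¬⁻ {w} {A} (holds h) with eval F V w A | h
  ... | false | _ = refl

  ⊩∧⁺ : w ⊩ A → w ⊩ B → w ⊩ A ∧' B
  ⊩∧⁺ (holds a) (holds b) =
    holds (subst₂ (λ x y → (x ⇒ᵇ (y ⇒ᵇ false)) ⇒ᵇ false ≡ true) (sym a) (sym b) refl)

  ⊩∧⁻ : w ⊩ A ∧' B → w ⊩ A × w ⊩ B
  ⊩∧⁻ {w} {A} {B} (holds h) with eval F V w A in a | eval F V w B in b | h
  ... | true | true | _ = holds a , holds b

  ⊩∨⁺ : w ⊩ A ⊎ w ⊩ B → w ⊩ A ∨' B
  ⊩∨⁺ {w} {B = B} (inj₁ (holds a)) =
    holds (subst (λ x → (x ⇒ᵇ false) ⇒ᵇ eval F V w B ≡ true) (sym a) refl)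
  ⊩∨⁺ (inj₂ (holds b)) = holds (⇒ᵇ-intro λ _ → b)

  ⊩∨⁻ : w ⊩ A ∨' B → w ⊩ A ⊎ w ⊩ B
  ⊩∨⁻ {w} {A} (holds h) with eval F V w A in a
  ... | true  = inj₁ (holds a)
  ... | false = inj₂ (holds h)

  ⊩□⁺ : (∀ v → R F w v ≡ true → v ⊩ A) → w ⊩ □ A
  ⊩□⁺ h = holds (allFin≡true⁺ (λ v → ⇒ᵇ-intro (truth ∘ h v)))

  ⊩□⁻ : w ⊩ □ A → ∀ v → R F w v ≡ true → v ⊩ A
  ⊩□⁻ (holds h) v r = holds (⇒ᵇ-elim (allFin≡true⁻ h v) r)

  ⊩[≠]⁺ : (∀ v → RD F w v ≡ true → v ⊩ A) → w ⊩ [≠] A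
  ⊩[≠]⁺ h = holds (allFin≡true⁺ (λ v → ⇒ᵇ-intro (truth ∘ h v)))

  ⊩[≠]⁻ : w ⊩ [≠] A → ∀ v → RD F w v ≡ true → v ⊩ A
  ⊩[≠]⁻ (holds h) v r = holds (⇒ᵇ-elim (allFin≡true⁻ h v) r)

  ⊩⟨≠⟩⁺ : RD F w v ≡ true → v ⊩ A → w ⊩ ⟨≠⟩ A
  ⊩⟨≠⟩⁺ {v = v} {A} r (holds a) =
    ⊩¬⁺ {A = [≠] (¬' A)} (allFin≡false⁺ v (⇒ᵇ≡false⁺ r (⇒ᵇ≡false⁺ a refl)))

  ⊩◇⁻ : w ⊩ ◇ A → ∃ λ v → R F w v ≡ true × v ⊩ A
  ⊩◇⁻ {A = A} h
    with v , e ← allFin≡false⁻ (⊩¬⁻ {A = □ (¬' A)} h)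
    with r , ¬a ← ⇒ᵇ≡false⁻ e
    with a , _ ← ⇒ᵇ≡false⁻ ¬a
    = v , r , holds a

module Correspondence (F : Frame) (valid : ValidatesDT1CK F) where

  ⟦_⟧ : (W F → Bool) → Valuation F
  ⟦ S ⟧ _ = S

  p : Fm
  p = var 0

  private
    variable
      x y z z′ : W F

  R⊆RD : R F x y ≡ true → RD F x y ≡ true
  R⊆RD {x} {y} = truth ∘ ⊩□⁻ (⊩⇒⁻ (valid⇒⊩ valid (ax-incl p)) (⊩[≠]⁺ λ _ → holds)) y
    where open Semantics F ⟦ RD F x ⟧

  RD-sym : RD F x y ≡ true → RD F y x ≡ true
  RD-sym {x} {y} r = truth (⊩⇒⁻ (valid⇒⊩ valid (ax-B≠ p)) (⊩⟨≠⟩⁺ r (⊩[≠]⁺ λ _ → holds)))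
    where open Semantics F ⟦ RD F y ⟧

  RD-weaklyTransitive : RD F x y ≡ true → RD F y z ≡ true → x ≢ z → RD F x z ≡ true
  RD-weaklyTransitive {x} {y} {z} rxy ryz x≢z =
    around⇒RD (truth (⊩[≠]⁻ (⊩[≠]⁻ [≠][≠]p y rxy) z ryz))
    where
    around : W F → Bool
    around u = does (u ≟ x) ∨ RD F x u
    open Semantics F ⟦ around ⟧
    x∈around : around x ≡ true
    x∈around rewrite dec-true (x ≟ x) refl = refl
    RD⇒around : ∀ {u} → RD F x u ≡ true → around u ≡ true
    RD⇒around r = trans (cong (_ ∨_) r) (∨-zeroʳ _)
    [≠][≠]p : x ⊩ [≠] ([≠] p)
    [≠][≠]p = ⊩⇒⁻ (valid⇒⊩ valid (ax-wD p)) (⊩∧⁺ (holds x∈around) (⊩[≠]⁺ λ _ → holds ∘ RD⇒around))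
    around⇒RD : around z ≡ true → RD F x z ≡ true
    around⇒RD rewrite dec-false (z ≟ x) (x≢z ∘ sym) = id

  RD∘R⊆RD : RD F x y ≡ true → R F y z ≡ true → RD F x z ≡ true
  RD∘R⊆RD {x} {y} {z} rxy ryz =
    truth (⊩□⁻ (⊩[≠]⁻ (⊩⇒⁻ (valid⇒⊩ valid (ax-mix p)) (⊩[≠]⁺ λ _ → holds)) y rxy) z ryz)
    where open Semantics F ⟦ RD F x ⟧

  R-serial : ∀ x → ∃ λ y → R F x y ≡ true
  R-serial x = map₂ proj₁ (⊩◇⁻ (valid⇒⊩ {w = x} valid ax-ser))
    where open Semantics F (λ _ _ → true)

  Uniform : (W F → Bool) → W F → Set
  Uniform S y = ∀ z → R F y z ≡ true → S z ≡ S y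

  □̄p∨□̄¬p : Fm
  □̄p∨□̄¬p = □̄ p ∨' □̄ (¬' p)

  module _ {S : W F → Bool} where
    open Semantics F ⟦ S ⟧

    Uniform⇒⊩□̄p∨□̄¬p : Uniform S y → y ⊩ □̄p∨□̄¬p
    Uniform⇒⊩□̄p∨□̄¬p {y} u with S y in e
    ... | true  = ⊩∨⁺ (inj₁ (⊩∧⁺ (⊩□⁺ λ z r → holds (u z r)) (holds e)))
    ... | false = ⊩∨⁺ (inj₂ (⊩∧⁺ (⊩□⁺ λ z r → ⊩¬⁺ (u z r)) (⊩¬⁺ e)))

    R-successors-agree : (∀ z → R F y z ≡ true → Uniform S z) →
                         R F y z ≡ true → R F y z′ ≡ true → S z ≡ S z′
    R-successors-agree {y} {z} {z′} u r r′
      with ⊩∨⁻ (⊩⇒⁻ (valid⇒⊩ valid (ax-c□ p)) (⊩□⁺ λ v rv → Uniform⇒⊩□̄p∨□̄¬p (u v rv)))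
    ... | inj₁ all  = trans (truth (⊩□⁻ all z r)) (sym (truth (⊩□⁻ all z′ r′)))
    ... | inj₂ none = trans (⊩¬⁻ (⊩□⁻ none z r)) (sym (⊩¬⁻ (⊩□⁻ none z′ r′)))

    RD-successors-agree : Uniform S x → (∀ v → RD F x v ≡ true → Uniform S v) →
                          RD F x y ≡ true → S y ≡ S x
    RD-successors-agree {x} {y} ux u r
      with ⊩∨⁻ (⊩⇒⁻ (valid⇒⊩ valid (ax-c≠ p))
                    (⊩∧⁺ (⊩[≠]⁺ λ v rv → Uniform⇒⊩□̄p∨□̄¬p (u v rv)) (Uniform⇒⊩□̄p∨□̄¬p ux)))
    ... | inj₁ positive with all , at-x ← ⊩∧⁻ positive =
      trans (truth (⊩[≠]⁻ all y r)) (sym (truth at-x))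
    ... | inj₂ negative with none , at-x ← ⊩∧⁻ negative =
      trans (⊩¬⁻ (⊩[≠]⁻ none y r)) (sym (⊩¬⁻ at-x))

module Reachability {n : ℕ} (E : Rel (Fin n) 0ℓ) (E? : Decidable E) (a : Fin n) where

  record Component : Set where
    field
      members   : Subset n
      source    : a ∈ members
      closed    : ∀ {u v} → u ∈ members → E u v → v ∈ members
      reachable : ∀ {v} → v ∈ members → Star E a v

  private
    Exit : Subset n → Set
    Exit S = ∃ λ u → ∃ λ v → u ∈ S × v ∉ S × E u v

    exit? : ∀ S → Dec (Exit S)
    exit? S = any? λ u → any? λ v → u ∈? S ×-dec ¬? (v ∈? S) ×-dec E? u v

    grow : ∀ S → Acc _⊃_ S → a ∈ S → (∀ {v} → v ∈ S → Star E a v) → Component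
    grow S (acc larger) a∈S reach with exit? S
    ... | no ¬exit = record
      { members = S ; source = a∈S ; reachable = reach
      ; closed = λ {u} {v} u∈S e →
          decidable-stable (v ∈? S) λ v∉S → ¬exit (u , v , u∈S , v∉S , e) }
    ... | yes (u , v , u∈S , v∉S , e) =
      grow (S ∪ ⁅ v ⁆) (larger (p⊆p∪q ⁅ v ⁆ , v , x∈p∪q⁺ (inj₂ (x∈⁅x⁆ v)) , v∉S))
           (p⊆p∪q ⁅ v ⁆ a∈S) reach′
      where
      reach′ : ∀ {w} → w ∈ S ∪ ⁅ v ⁆ → Star E a w
      reach′ w∈ with x∈p∪q⁻ S ⁅ v ⁆ w∈
      ... | inj₁ w∈S = reach w∈S
      ... | inj₂ w∈v rewrite x∈⁅y⁆⇒x≡y v w∈v = reach u∈S ◅◅ (e ◅ ε)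

  component : Component
  component = grow ⁅ a ⁆ (⊃-wellFounded _) (x∈⁅x⁆ a)
                   λ v∈ → subst (Star E a) (sym (x∈⁅y⁆⇒x≡y a v∈)) ε

lookup-injective-on-filter : ∀ {A : Set} {P : Pred A 0ℓ} (P? : Decidable₁ P) (xs : List A) →
  Unique (filter P? xs) → ∀ i j → P (lookup xs i) → lookup xs i ≡ lookup xs j → i ≡ j
lookup-injective-on-filter P? (x ∷ xs) u zero zero _ _ = refl
lookup-injective-on-filter P? (x ∷ xs) u zero (suc j) px x≡xs[j]
  with x≢ ∷ _ ← subst Unique (filter-accept P? px) u
  = ⊥-elim (All.lookup x≢ (∈-filter⁺ P? (subst (_∈ˡ xs) (sym x≡xs[j]) (∈-lookup j)) px) refl)
lookup-injective-on-filter {P = P} P? (x ∷ xs) u (suc i) zero px eq =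
  sym (lookup-injective-on-filter P? (x ∷ xs) u zero (suc i) (subst P eq px) (sym eq))
lookup-injective-on-filter {P = P} P? (x ∷ xs) u (suc i) (suc j) px eq =
  cong suc (lookup-injective-on-filter P? xs (unique-tail (P? x)) i j px eq)
  where
  unique-tail : Dec (P x) → Unique (filter P? xs)
  unique-tail (yes px) with _ ∷ u′ ← subst Unique (filter-accept P? px) u = u′
  unique-tail (no ¬px) = subst Unique (filter-reject P? ¬px) u

module Walks (F : Frame) where

  D-reflexive D-irreflexive : W F → Set
  D-reflexive v = RD F v v ≡ true
  D-irreflexive v = RD F v v ≡ false

  D-irreflexive? : Decidable₁ D-irreflexive
  D-irreflexive? v = RD F v v ≟ᵇ false

  reflexive⇒¬irreflexive : ∀ {v} → D-reflexive v → ¬ D-irreflexive v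
  reflexive⇒¬irreflexive r i with () ← trans (sym r) i

  irreflexives : List (W F) → List (W F)
  irreflexives = filter D-irreflexive?

  private
    variable
      a b c v z : W F
      xs ys L L′ : List (W F)

  data Trail : W F → W F → List (W F) → Set where
    []  : Trail a a []
    _∷_ : R± F a b → Trail b c xs → Trail a c (b ∷ xs)

  _++ᵀ_ : Trail a b xs → Trail b c ys → Trail a c (xs ++ ys)
  []      ++ᵀ t′ = t′
  (s ∷ t) ++ᵀ t′ = s ∷ (t ++ᵀ t′)

  Trail⇒IsPath : Trail a b xs → IsPath F (length xs) (lookup (a ∷ xs))
  Trail⇒IsPath (s ∷ t) zero    = s
  Trail⇒IsPath (s ∷ t) (suc i) = Trail⇒IsPath t i

  Trail⇒lookup-last : Trail a b xs → lookup (a ∷ xs) (fromℕ (length xs)) ≡ b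
  Trail⇒lookup-last []      = refl
  Trail⇒lookup-last (s ∷ t) = Trail⇒lookup-last t

  Trail⇒end∈ : Trail a b xs → b ∈ˡ a ∷ xs
  Trail⇒end∈ []      = here refl
  Trail⇒end∈ (s ∷ t) = there (Trail⇒end∈ t)

  Link : Rel (W F) 0ℓ
  Link u v = D-reflexive u × D-reflexive v × (R F u v ≡ true ⊎ R F v u ≡ true)

  link? : Decidable Link
  link? u v = (RD F u u ≟ᵇ true) ×-dec (RD F v v ≟ᵇ true)
              ×-dec ((R F u v ≟ᵇ true) ⊎-dec (R F v u ≟ᵇ true))

  Link-sym : ∀ {u v} → Link u v → Link v u
  Link-sym (ru , rv , r) = rv , ru , swap r

  Star-Link⇒Trail : Star Link a b → ∃ λ xs → Trail a b xs × All D-reflexive xs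
  Star-Link⇒Trail ε = [] , [] , []
  Star-Link⇒Trail ((_ , rv , r) ◅ s) with xs , t , rs ← Star-Link⇒Trail s =
    _ ∷ xs , Sum.map₂ inj₁ r ∷ t , rv ∷ rs

  record Tour (a b : W F) (L : List (W F)) : Set where
    field
      stops  : List (W F)
      trail  : Trail a b stops
      covers : ∀ {v} → v ∈ˡ L → v ∈ˡ a ∷ stops
      irreflexive-stops : irreflexives stops ≡ irreflexives L

  _⊕_ : Tour a b L → Tour b c L′ → Tour a c (L ++ L′)
  _⊕_ {a} {L = L} {L′ = L′} t t′ = record
    { stops  = T.stops ++ T′.stops
    ; trail  = T.trail ++ᵀ T′.trail
    ; covers = λ m → Sum.[ ∈-++⁺ˡ ∘ T.covers , later ∘ T′.covers ] (∈-++⁻ L m)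
    ; irreflexive-stops = begin
        irreflexives (T.stops ++ T′.stops)            ≡⟨ filter-++ D-irreflexive? T.stops T′.stops ⟩
        irreflexives T.stops ++ irreflexives T′.stops ≡⟨ cong₂ _++_ T.irreflexive-stops T′.irreflexive-stops ⟩
        irreflexives L ++ irreflexives L′             ≡⟨ filter-++ D-irreflexive? L L′ ⟨
        irreflexives (L ++ L′)                        ∎ }
    where
    module T = Tour t
    module T′ = Tour t′
    open ≡-Reasoning
    later : ∀ {v} → v ∈ˡ _ ∷ T′.stops → v ∈ˡ a ∷ T.stops ++ T′.stops
    later (here refl) = ∈-++⁺ˡ (Trail⇒end∈ T.trail)
    later (there m)   = ∈-++⁺ʳ (a ∷ T.stops) m

  stay : Tour a a []
  stay = record { stops = [] ; trail = [] ; covers = λ () ; irreflexive-stops = refl }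

  pause : D-reflexive a → Tour a a [ a ]
  pause r = record
    { stops = [] ; trail = [] ; covers = λ { (here refl) → here refl }
    ; irreflexive-stops = sym (filter-reject D-irreflexive? (reflexive⇒¬irreflexive r)) }

  detour : D-irreflexive v → R F v z ≡ true → D-reflexive z → Tour z z [ v ]
  detour {v} {z} i r rz = record
    { stops = v ∷ z ∷ []
    ; trail = inj₂ (inj₁ r) ∷ (inj₁ r ∷ [])
    ; covers = λ { (here refl) → there (here refl) }
    ; irreflexive-stops = begin
        irreflexives (v ∷ z ∷ []) ≡⟨ filter-accept D-irreflexive? i ⟩
        v ∷ irreflexives [ z ]    ≡⟨ cong (v ∷_) (filter-reject D-irreflexive? (reflexive⇒¬irreflexive rz)) ⟩
        [ v ]                     ≡⟨ filter-accept D-irreflexive? i ⟨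
        irreflexives [ v ]        ∎ }
    where open ≡-Reasoning

  Star-Link⇒Tour : Star Link a b → Tour a b []
  Star-Link⇒Tour s with xs , t , rs ← Star-Link⇒Trail s = record
    { stops = xs ; trail = t ; covers = λ ()
    ; irreflexive-stops = filter-none D-irreflexive? (All.map reflexive⇒¬irreflexive rs) }

module RootedFrame (F : Frame) (valid : ValidatesDT1CK F) (rooted : Rooted F) where
  open Correspondence F valid
  open Walks F

  private
    variable
      a b v x y : W F

  near-root : ∀ y → proj₁ rooted ≡ y ⊎ RD F (proj₁ rooted) y ≡ true
  near-root y = near-star (inj₁ refl) (proj₂ rooted y)
    where
    x₀ = proj₁ rooted
    Near : W F → Set
    Near u = x₀ ≡ u ⊎ RD F x₀ u ≡ true
    near-step : ∀ {u v} → Near u → R∪RD F u v → Near v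
    near-step {v = v} n s with RD-step ← Sum.[ R⊆RD , id ]′ s | n | x₀ ≟ v
    ... | inj₁ refl | _        = inj₂ RD-step
    ... | inj₂ _    | yes x₀≡v = inj₁ x₀≡v
    ... | inj₂ r    | no x₀≢v  = inj₂ (RD-weaklyTransitive r RD-step x₀≢v)
    near-star : ∀ {u v} → Near u → Star (R∪RD F) u v → Near v
    near-star n ε        = n
    near-star n (s ◅ ss) = near-star (near-step n s) ss

  RD-total : x ≢ y → RD F x y ≡ true
  RD-total {x} {y} x≢y with near-root x | near-root y
  ... | inj₁ refl | inj₁ refl = ⊥-elim (x≢y refl)
  ... | inj₁ refl | inj₂ r    = r
  ... | inj₂ r    | inj₁ refl = RD-sym r
  ... | inj₂ r    | inj₂ r′   = RD-weaklyTransitive (RD-sym r) r′ x≢y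

  R-targets-reflexive : R F x y ≡ true → D-reflexive y
  R-targets-reflexive {x} {y} r with x ≟ y
  ... | yes refl = R⊆RD r
  ... | no x≢y   = RD∘R⊆RD (RD-total (x≢y ∘ sym)) r

  anchor : W F → W F
  anchor v with RD F v v
  ... | true  = v
  ... | false = proj₁ (R-serial v)

  anchor-cases : ∀ v → (D-reflexive v × anchor v ≡ v) ⊎ R F v (anchor v) ≡ true
  anchor-cases v with RD F v v
  ... | true  = inj₁ (refl , refl)
  ... | false = inj₂ (proj₂ (R-serial v))

  anchor-reflexive : D-reflexive v → anchor v ≡ v
  anchor-reflexive {v} rv with RD F v v | rv
  ... | true | _ = refl

  Link-invariant : (W F → Bool) → Set
  Link-invariant S = ∀ {u v} → Link u v → S u ≡ S v

  module _ {S : W F → Bool} (invariant : Link-invariant S) where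

    Link-invariant⇒Uniform : D-reflexive y → Uniform S y
    Link-invariant⇒Uniform ry z r = sym (invariant (ry , R-targets-reflexive r , inj₁ r))

    Link-invariant⇒Uniform∘anchor : ∀ y → Uniform (S ∘ anchor) y
    Link-invariant⇒Uniform∘anchor y z r rewrite anchor-reflexive (R-targets-reflexive r)
      with anchor-cases y
    ... | inj₁ (ry , eq) rewrite eq = Link-invariant⇒Uniform ry z r
    ... | inj₂ r′ = R-successors-agree (λ _ → Link-invariant⇒Uniform ∘ R-targets-reflexive) r r′

    Link-invariant⇒constant : D-reflexive a → D-reflexive b → S a ≡ S b
    Link-invariant⇒constant {a} {b} ra rb with a ≟ b
    ... | yes refl = refl
    ... | no a≢b   = begin
      S a            ≡⟨ cong S (anchor-reflexive ra) ⟨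
      S (anchor a)   ≡⟨ RD-successors-agree (Link-invariant⇒Uniform∘anchor a)
                          (λ v _ → Link-invariant⇒Uniform∘anchor v) (RD-total a≢b) ⟨
      S (anchor b)   ≡⟨ cong S (anchor-reflexive rb) ⟩
      S b            ∎
      where open ≡-Reasoning

  D-reflexive-connected : D-reflexive a → D-reflexive b → Star Link a b
  D-reflexive-connected {a} {b} ra rb = reachable (member⁻ (begin
    T b  ≡⟨ Link-invariant⇒constant T-invariant ra rb ⟨
    T a  ≡⟨ dec-true (a ∈? members) source ⟩
    true ∎))
    where
    open Reachability.Component (Reachability.component Link link? a)
    open ≡-Reasoning
    T : W F → Bool
    T v = does (v ∈? members)
    T-invariant : Link-invariant T
    T-invariant {u} {v} link = does-⇔ (mk⇔ (λ u∈ → closed u∈ link) (λ v∈ → closed v∈ (Link-sym link)))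
                                      (u ∈? members) (v ∈? members)
    member⁻ : T b ≡ true → b ∈ members
    member⁻ h with b ∈? members | h
    ... | yes b∈ | _ = b∈

  bridge : D-reflexive a → D-reflexive b → Tour a b []
  bridge ra rb = Star-Link⇒Tour (D-reflexive-connected ra rb)

  visit : D-reflexive a → ∀ v → ∃ λ b → D-reflexive b × Tour a b [ v ]
  visit ra v with RD F v v in e
  ... | true  = v , e , bridge ra e ⊕ pause e
  ... | false with z , r ← R-serial v =
    let rz = R-targets-reflexive r in z , rz , bridge ra rz ⊕ detour e r rz

  tour : D-reflexive a → ∀ L → ∃ λ b → D-reflexive b × Tour a b L
  tour {a} ra []      = a , ra , stay
  tour ra (v ∷ L) with b , rb , t ← visit ra v with c , rc , t′ ← tour rb L = c , rc , t ⊕ t′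

  grand-tour : D-reflexive a → D-reflexive b → Tour a b (List.allFin (size F))
  grand-tour {a} {b} ra rb with c , rc , t ← tour ra (List.allFin (size F)) =
    subst (Tour a b) (++-identityʳ _) (t ⊕ bridge rc rb)

lemma11p3 : (F : Frame) → Rooted F → ValidatesDT1CK F →
    (w′ w″ : W F) → RD F w′ w′ ≡ true → RD F w″ w″ ≡ true →
    ∃ λ (k : ℕ) → ∃ λ (α : Fin (suc k) → W F) →
    IsPath F k α × (α zero ≡ w′) × (α (fromℕ k) ≡ w″) ×
    IsGlobal F k α × IrreflOnce F k α
lemma11p3 F rooted valid w′ w″ r′ r″ =
  length stops , lookup (w′ ∷ stops) ,
  Trail⇒IsPath trail , refl , Trail⇒lookup-last trail , global , once
  where
  open Walks F
  open RootedFrame F valid rooted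
  open Tour (grand-tour r′ r″)
  global : IsGlobal F (length stops) (lookup (w′ ∷ stops))
  global v with m ← covers (∈-allFin v) = index m , inj₁ (sym (lookup-index m))
  unique : Unique (irreflexives (w′ ∷ stops))
  unique = subst Unique
    (sym (trans (filter-reject D-irreflexive? (reflexive⇒¬irreflexive r′)) irreflexive-stops))
    (Unique.filter⁺ D-irreflexive? (Unique.allFin⁺ (size F)))
  once : IrreflOnce F (length stops) (lookup (w′ ∷ stops))
  once = lookup-injective-on-filter D-irreflexive? (w′ ∷ stops) unique
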